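{- A $2$-permutation $\sigma$ is fully $2$-rooted cuttable if and only if it avoids the pattern $b\cdot b'\cdot c\cdot a$ with $a\le b,b'\le c$, i.e. there are no positions $p_1<p_2<p_3<p_4$ with $\sigma_{p_1}=b$, $\sigma_{p_2}=b'$, $\sigma_{p_3}=c$, $\sigma_{p_4}=a$ satisfying $a\le b\le c$ and $a\le b'\le c$.
   Context: A $2$-permutation of degree $n$ is a word on the multiset $\{1,1,2,2,\dots,n,n\}$. For such $\sigma$ and $\gamma\in[n-1]$, $\gamma$ is a $2$-rooted cut of $\sigma$ if $\sigma=\alpha\beta\delta$ with $|\alpha|=2$, every letter of $\beta$ at most $\gamma$ and every letter of $\delta$ greater than $\gamma$; $\sigma$ is $2$-rooted cuttable if it has a $2$-rooted cut. For $L=\{\ell_1<\dots<\ell_q\}\subseteq[n]$, $\sigma^{|L}$ keeps the letters in $L$ and replaces $\ell_x$ by $x$. $\sigma$ is fully $2$-rooted cuttable if $\sigma^{|[a,b]}$ is $2$-rooted cuttable for every interval $[a,b]\subseteq[n]$ with $a<b$. -}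

module Defs where

open import Data.Nat using (ℕ; zero; suc; _+_; _∸_; _≤_; _<_; _≤ᵇ_)
open import Data.Nat.Properties using (_≟_)
open import Data.Bool using (Bool; _∧_; T?)
open import Data.List using (List; []; _∷_; _++_; length; filter; map; lookup)
open import Data.List.Relation.Unary.All using (All)
open import Data.Fin using (Fin; toℕ)
open import Data.Product using (Σ; ∃; ∃-syntax; _×_; _,_)
open import Relation.Binary.PropositionalEquality using (_≡_)
open import Relation.Nullary using (¬_)
open import Relation.Nullary.Decidable using (⌊_⌋)
open import Data.Nat using (_≤?_)

Is2Perm : ℕ → List ℕ → Set
Is2Perm n σ =
  All (λ x → 1 ≤ x × x ≤ n) σ ×
  (∀ i → 1 ≤ i → i ≤ n → length (filter (_≟ i) σ) ≡ 2)

Is2RootedCut : ℕ → List ℕ → ℕ → Set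
Is2RootedCut n σ γ =
  1 ≤ γ × γ < n ×
  ∃[ α ] ∃[ β ] ∃[ δ ]
    (σ ≡ α ++ β ++ δ × length α ≡ 2 ×
     All (λ x → x ≤ γ) β × All (λ x → γ < x) δ)

Is2RootedCuttable : ℕ → List ℕ → Set
Is2RootedCuttable n σ = ∃[ γ ] Is2RootedCut n σ γ

inInterval : ℕ → ℕ → ℕ → Bool
inInterval a b x = ⌊ a ≤? x ⌋ ∧ ⌊ x ≤? b ⌋

-- σ^{|[a,b]}: keep letters in [a,b], replace the x-th smallest element
-- of [a,b] (namely a + x - 1) by x, i.e. letter y ↦ y ∸ a + 1.
restrict : ℕ → ℕ → List ℕ → List ℕ
restrict a b σ = map (λ y → suc (y ∸ a)) (filter (λ y → T? (inInterval a b y)) σ)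

IsFully2RootedCuttable : ℕ → List ℕ → Set
IsFully2RootedCuttable n σ =
  ∀ a b → 1 ≤ a → a < b → b ≤ n → Is2RootedCuttable (suc (b ∸ a)) (restrict a b σ)

ContainsPattern : List ℕ → Set
ContainsPattern σ =
  ∃[ p₁ ] ∃[ p₂ ] ∃[ p₃ ] ∃[ p₄ ]
    (toℕ p₁ < toℕ p₂ × toℕ p₂ < toℕ p₃ × toℕ p₃ < toℕ p₄ ×
     lookup σ p₄ ≤ lookup σ p₁ × lookup σ p₁ ≤ lookup σ p₃ ×
     lookup σ p₄ ≤ lookup σ p₂ × lookup σ p₂ ≤ lookup σ p₃)

Avoids : List ℕ → Set
Avoids σ = ¬ ContainsPattern σ

-- If σ contains it with a < c, then in σ restricted
-- to [a, c] the letters c and a become the top letter and 1, and both occur after the first two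
-- positions, so no 2-rooted cut can separate them; if a = c the pattern is four copies of a.
-- Conversely, write a restriction as x·y·r and cut r just before its first letter c with
-- c ≥ x ⊔ y and c > x ⊓ y. A later letter d ≤ x ⊓ y would give the pattern x·y·c·d, and a later
-- d ≤ u for an earlier u < x ⊔ y the pattern (x ⊔ y)·u·c·d; so everything after the cut lies
-- above everything before it, and the cut value is the maximum of A and the letters before c.

module Submission where

open import Defs
open import Data.Nat using (ℕ; zero; suc; _∸_; _≤_; _<_; _⊔_; _⊓_; _≤?_; _<?_; z≤n; s≤s)
open import Data.Nat.Properties
  using (_≟_; ≤-refl; ≤-trans; ≤-antisym; ≤-reflexive; <⇒≤; <⇒≱; ≮⇒≥; ≰⇒>; ≤∧≢⇒<; ≤-<-trans; <-≤-trans;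
         n<1+n; n∸n≡0; ∸-monoˡ-≤; ∸-monoˡ-<; ⊔-sel; ⊔-lub; ⊓-glb; m⊓n≤m; m⊓n≤n; m≤m⊔n; m≤n⊔m)
open import Data.Bool using (T; T?)
open import Data.Bool.Properties using (T-∧)
open import Data.Sum using (_⊎_; inj₁; inj₂; [_,_]′)
open import Data.Product using (∃₂; ∃-syntax; _×_; _,_)
open import Data.Fin using (Fin; toℕ; zero; suc)
open import Data.List
  using (List; []; _∷_; _++_; length; filter; map; lookup; drop; replicate; takeWhile; dropWhile; head)
open import Data.List.Properties
  using (map-++; filter-all; filter-accept; filter-reject; length-replicate; takeWhile++dropWhile)
open import Data.List.Membership.Propositional using (_∈_)
open import Data.List.Membership.Propositional.Properties using (∈-++⁺ˡ)
open import Data.List.Relation.Unary.All using (All; []; _∷_)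
import Data.List.Relation.Unary.All as All
open import Data.List.Relation.Unary.All.Properties
  using (all-filter; all-takeWhile; all-head-dropWhile; replicate⁺) renaming (map⁺ to All-map⁺)
open import Data.Maybe.Relation.Unary.All using (just) renaming (All to MaybeAll)
open import Data.List.Relation.Binary.Sublist.Propositional
  using (_⊆_; []; _∷_; _∷ʳ_; ⊆-trans; ⊆-reflexive; minimum; from∈)
open import Data.List.Relation.Binary.Sublist.Propositional.Properties
  using (All-resp-⊆; filter⁺; filter-⊆; map⁺; ∷ˡ⁻; ++⁺; ++⁺ˡ; drop⁺-≥; drop⁺-⊆; length-mono-≤)
open import Data.List.Extrema.Nat using (max; ⊥≤max; xs≤max; max<v⁺)
open import Function using (_∘_; Equivalence)
open import Relation.Binary.PropositionalEquality using (_≡_; refl; sym; trans; cong; subst)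
open import Relation.Nullary using (¬_; yes; no; contradiction)
open import Relation.Nullary.Decidable using (⌊_⌋; _⊎-dec_; fromWitness; toWitness)
open import Relation.Unary using (Pred; Decidable)

HasPattern : List ℕ → Set
HasPattern σ = ∃[ b ] ∃[ b' ] ∃[ c ] ∃[ a ]
  (b ∷ b' ∷ c ∷ a ∷ [] ⊆ σ × a ≤ b × b ≤ c × a ≤ b' × b' ≤ c)

HasPattern-⊆ : ∀ {xs ys : List ℕ} → xs ⊆ ys → HasPattern xs → HasPattern ys
HasPattern-⊆ xs⊆ys (b , b' , c , a , pat⊆xs , shape) = b , b' , c , a , ⊆-trans pat⊆xs xs⊆ys , shape

lookup∷⊆drop : ∀ σ (p : Fin (length σ)) {ys : List ℕ} →
  ys ⊆ drop (suc (toℕ p)) σ → lookup σ p ∷ ys ⊆ drop (toℕ p) σ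
lookup∷⊆drop (x ∷ σ) zero    ys⊆ = refl ∷ ys⊆
lookup∷⊆drop (x ∷ σ) (suc p) ys⊆ = lookup∷⊆drop σ p ys⊆

∷⊆drop⇒lookup : ∀ σ k {x : ℕ} {ys} → x ∷ ys ⊆ drop k σ →
  ∃[ p ] (k ≤ toℕ p × lookup σ p ≡ x × ys ⊆ drop (suc (toℕ p)) σ)
∷⊆drop⇒lookup []      zero    ()
∷⊆drop⇒lookup []      (suc k) ()
∷⊆drop⇒lookup (y ∷ σ) zero    (refl ∷ ys⊆) = zero , z≤n , refl , ys⊆
∷⊆drop⇒lookup (y ∷ σ) zero    (y ∷ʳ xys⊆) with ∷⊆drop⇒lookup σ zero xys⊆
... | p , _ , lookup≡x , ys⊆ = suc p , z≤n , lookup≡x , ys⊆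
∷⊆drop⇒lookup (y ∷ σ) (suc k) xys⊆ with ∷⊆drop⇒lookup σ k xys⊆
... | p , k≤p , lookup≡x , ys⊆ = suc p , s≤s k≤p , lookup≡x , ys⊆

ContainsPattern⇒HasPattern : ∀ σ → ContainsPattern σ → HasPattern σ
ContainsPattern⇒HasPattern σ (p₁ , p₂ , p₃ , p₄ , p₁<p₂ , p₂<p₃ , p₃<p₄ , shape) =
  _ , _ , _ , _ ,
  ⊆-trans (before p₁ p₂ p₁<p₂ (before p₂ p₃ p₂<p₃ (before p₃ p₄ p₃<p₄ (lookup∷⊆drop σ p₄ (minimum _)))))
          (drop⁺-≥ {m = toℕ p₁} z≤n) ,
  shape
  where
    before : ∀ p q {ys : List ℕ} → toℕ p < toℕ q → ys ⊆ drop (toℕ q) σ → lookup σ p ∷ ys ⊆ drop (toℕ p) σ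
    before p q p<q ys⊆ = lookup∷⊆drop σ p (⊆-trans ys⊆ (drop⁺-≥ p<q))

HasPattern⇒ContainsPattern : ∀ σ → HasPattern σ → ContainsPattern σ
HasPattern⇒ContainsPattern σ (b , b' , c , a , pat⊆σ , a≤b , b≤c , a≤b' , b'≤c)
  with ∷⊆drop⇒lookup σ 0 pat⊆σ
... | p₁ , _ , refl , s₁ with ∷⊆drop⇒lookup σ _ s₁
... | p₂ , p₁<p₂ , refl , s₂ with ∷⊆drop⇒lookup σ _ s₂
... | p₃ , p₂<p₃ , refl , s₃ with ∷⊆drop⇒lookup σ _ s₃
... | p₄ , p₃<p₄ , refl , _ = p₁ , p₂ , p₃ , p₄ , p₁<p₂ , p₂<p₃ , p₃<p₄ , a≤b , b≤c , a≤b' , b'≤c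

occurrences : ℕ → List ℕ → ℕ
occurrences v xs = length (filter (_≟ v) xs)

occurrences-mono : ∀ v {xs ys} → xs ⊆ ys → occurrences v xs ≤ occurrences v ys
occurrences-mono v xs⊆ys = length-mono-≤ (filter⁺ (_≟ v) (_≟ v) (λ { refl x≡v → x≡v }) xs⊆ys)

occurrences-replicate : ∀ v k → occurrences v (replicate k v) ≡ k
occurrences-replicate v k = trans (cong length (filter-all (_≟ v) (replicate⁺ k refl))) (length-replicate k)

replicate-occurrences-⊆ : ∀ v xs → replicate (occurrences v xs) v ⊆ xs
replicate-occurrences-⊆ v [] = []
replicate-occurrences-⊆ v (x ∷ xs) with x ≟ v
... | yes x≡v rewrite filter-accept (_≟ v) {xs = xs} x≡v = sym x≡v ∷ replicate-occurrences-⊆ v xs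
... | no x≢v  rewrite filter-reject (_≟ v) {xs = xs} x≢v = x ∷ʳ replicate-occurrences-⊆ v xs

two-copies-⊆ : ∀ {v} {xs : List ℕ} → occurrences v xs ≡ 2 → v ∷ v ∷ [] ⊆ xs
two-copies-⊆ {v} {xs} twice = subst (λ k → replicate k v ⊆ xs) twice (replicate-occurrences-⊆ v xs)

no-three-copies : ∀ {v} {xs : List ℕ} → occurrences v xs ≡ 2 → ¬ (v ∷ v ∷ v ∷ [] ⊆ xs)
no-three-copies {v} twice vvv⊆xs =
  <⇒≱ (n<1+n 2)
      (≤-trans (≤-reflexive (sym (occurrences-replicate v 3)))
               (≤-trans (occurrences-mono v vvv⊆xs) (≤-reflexive twice)))

⊆-filter : ∀ {a} {A : Set a} {P : Pred A a} (P? : Decidable P) {xs ys} →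
  All P xs → xs ⊆ ys → xs ⊆ filter P? ys
⊆-filter P? {ys = ys} Pxs xs⊆ys =
  subst (_⊆ filter P? ys) (filter-all P? Pxs) (filter⁺ P? P? (λ { refl p → p }) xs⊆ys)

inInterval? : (a b : ℕ) → Decidable (λ x → T (inInterval a b x))
inInterval? a b x = T? (inInterval a b x)

inInterval⁺ : ∀ {a b x} → a ≤ x → x ≤ b → T (inInterval a b x)
inInterval⁺ {a} {b} {x} a≤x x≤b =
  Equivalence.from (T-∧ {⌊ a ≤? x ⌋} {⌊ x ≤? b ⌋}) (fromWitness a≤x , fromWitness x≤b)

inInterval⁻ : ∀ {a b x} → T (inInterval a b x) → a ≤ x × x ≤ b
inInterval⁻ {a} {b} {x} t with Equivalence.to (T-∧ {⌊ a ≤? x ⌋} {⌊ x ≤? b ⌋}) t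
... | a≤x , x≤b = toWitness a≤x , toWitness x≤b

SplitsAt : ℕ → List ℕ → Set
SplitsAt γ r = ∃₂ λ β δ → r ≡ β ++ δ × All (_≤ γ) β × All (γ <_) δ

SplitsAt-map : ∀ {γ r} (f : ℕ → ℕ) → (∀ {u} → u ≤ γ → f u ≤ f γ) → (∀ {u} → γ < u → f γ < f u) →
  SplitsAt γ r → SplitsAt (f γ) (map f r)
SplitsAt-map f mono strict (β , δ , refl , β≤γ , γ<δ) =
  map f β , map f δ , map-++ f β δ , All-map⁺ (All.map mono β≤γ) , All-map⁺ (All.map strict γ<δ)

split-no-descent : ∀ {γ p q} β {δ} → All (_≤ γ) β → All (γ <_) δ →
  p ∷ q ∷ [] ⊆ β ++ δ → γ < p → γ < q
split-no-descent []      _         γ<δ pq⊆        _   = All.head (All.tail (All-resp-⊆ pq⊆ γ<δ))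
split-no-descent (e ∷ β) (_ ∷ β≤γ) γ<δ (e ∷ʳ pq⊆) γ<p = split-no-descent β β≤γ γ<δ pq⊆ γ<p
split-no-descent (e ∷ β) (e≤γ ∷ _) _   (refl ∷ _) γ<p = contradiction e≤γ (<⇒≱ γ<p)

Is2RootedCut⇒SplitsAt : ∀ {m w γ} → Is2RootedCut m w γ → SplitsAt γ (drop 2 w)
Is2RootedCut⇒SplitsAt (_ , _ , []          , _ , _ , _ , () , _)
Is2RootedCut⇒SplitsAt (_ , _ , _ ∷ []      , _ , _ , _ , () , _)
Is2RootedCut⇒SplitsAt (_ , _ , _ ∷ _ ∷ []  , β , δ , refl , refl , β≤γ , γ<δ) = β , δ , refl , β≤γ , γ<δ
Is2RootedCut⇒SplitsAt (_ , _ , _ ∷ _ ∷ _ ∷ _ , _ , _ , _ , () , _)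

fully-cuttable⇒avoids : ∀ n σ → Is2Perm n σ → IsFully2RootedCuttable n σ → ¬ HasPattern σ
fully-cuttable⇒avoids n σ (bounds , twice) cuttable (b , b' , c , a , pat⊆σ , a≤b , b≤c , a≤b' , b'≤c)
  with All-resp-⊆ pat⊆σ bounds
... | _ ∷ _ ∷ (_ , c≤n) ∷ (1≤a , _) ∷ [] with a <? c
... | no a≮c = no-three-copies (twice a 1≤a (≤-trans a≤c c≤n))
                 (⊆-trans (≤-antisym a≤b (≤-trans b≤c c≤a) ∷ ≤-antisym a≤b' (≤-trans b'≤c c≤a) ∷
                           ≤-antisym a≤c c≤a ∷ a ∷ʳ []) pat⊆σ)
  where
    a≤c = ≤-trans a≤b b≤c
    c≤a = ≮⇒≥ a≮c
... | yes a<c with cuttable a c 1≤a a<c c≤n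
... | γ , cut@(1≤γ , γ<top , _) with Is2RootedCut⇒SplitsAt cut
... | β , δ , eq , β≤γ , γ<δ =
  <⇒≱ (split-no-descent β β≤γ γ<δ (subst (_ ⊆_) eq ca⊆) γ<top)
      (subst (_≤ γ) (cong suc (sym (n∸n≡0 a))) 1≤γ)
  where
    a≤c = ≤-trans a≤b b≤c
    ca⊆ : suc (c ∸ a) ∷ suc (a ∸ a) ∷ [] ⊆ drop 2 (restrict a c σ)
    ca⊆ = drop⁺-⊆ 2 (map⁺ (λ z → suc (z ∸ a)) (⊆-filter (inInterval? a c)
            (inInterval⁺ a≤b b≤c ∷ inInterval⁺ a≤b' b'≤c ∷ inInterval⁺ a≤c ≤-refl ∷ inInterval⁺ ≤-refl a≤c ∷ [])
            pat⊆σ))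

SplitsAt⇒Is2RootedCut : ∀ {m x y r γ} → SplitsAt γ r → 1 ≤ γ → γ < m → Is2RootedCut m (x ∷ y ∷ r) γ
SplitsAt⇒Is2RootedCut (β , δ , refl , β≤γ , γ<δ) 1≤γ γ<m =
  1≤γ , γ<m , _ ∷ _ ∷ [] , β , δ , refl , refl , β≤γ , γ<δ

module _ {x y : ℕ} {r : List ℕ} (avoids : ¬ HasPattern (x ∷ y ∷ r)) where

  Low : ℕ → Set
  Low u = u < x ⊔ y ⊎ u ≤ x ⊓ y

  later-above-min : ∀ {c d} → x ⊔ y ≤ c → c ∷ d ∷ [] ⊆ r → x ⊓ y < d
  later-above-min {c} {d} M≤c cd⊆r = ≰⇒> λ d≤lo → avoids
    (x , y , c , d , refl ∷ refl ∷ cd⊆r ,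
     ≤-trans d≤lo (m⊓n≤m x y) , ≤-trans (m≤m⊔n x y) M≤c , ≤-trans d≤lo (m⊓n≤n x y) , ≤-trans (m≤n⊔m x y) M≤c)

  later-above-low : ∀ {u c d} → Low u → x ⊔ y ≤ c → u ∷ c ∷ d ∷ [] ⊆ r → u < d
  later-above-low {u} {c} {d} (inj₁ u<M) M≤c ucd⊆r = ≰⇒> λ d≤u → avoids
    (x ⊔ y , u , c , d , M∷ucd⊆ , ≤-trans d≤u (<⇒≤ u<M) , M≤c , d≤u , ≤-trans (<⇒≤ u<M) M≤c)
    where
      M∷ucd⊆ : x ⊔ y ∷ u ∷ c ∷ d ∷ [] ⊆ x ∷ y ∷ r
      M∷ucd⊆ = [ (λ M≡x → M≡x ∷ y ∷ʳ ucd⊆r) , (λ M≡y → x ∷ʳ M≡y ∷ ucd⊆r) ]′ (⊔-sel x y)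
  later-above-low (inj₂ u≤lo) M≤c ucd⊆r = ≤-<-trans u≤lo (later-above-min M≤c (∷ˡ⁻ ucd⊆r))

  suffix-above : ∀ {P S} → P ++ S ⊆ r → All Low P → MaybeAll (¬_ ∘ Low) (head S) →
                 All (λ d → x ⊓ y < d × All (_< d) P) S
  suffix-above {S = []}    _     _    _             = []
  suffix-above {P} {c ∷ S} PcS⊆r lowP (just ¬low-c) =
    (lo<c , All.map below-c lowP) ∷
    All.tabulate λ d∈S →
      later-above-min M≤c (⊆-trans (++⁺ˡ P (refl ∷ from∈ d∈S)) PcS⊆r) ,
      All.tabulate λ u∈P →
        later-above-low (All.lookup lowP u∈P) M≤c (⊆-trans (++⁺ (from∈ u∈P) (refl ∷ from∈ d∈S)) PcS⊆r)
    where
      M≤c = ≮⇒≥ (¬low-c ∘ inj₁)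
      lo<c = ≰⇒> (¬low-c ∘ inj₂)

      below-c : ∀ {u} → Low u → u < c
      below-c = [ (λ u<M → <-≤-trans u<M M≤c) , (λ u≤lo → ≤-<-trans u≤lo lo<c) ]′

  split-after-first-two : ∃₂ λ P S → r ≡ P ++ S × All Low P × All (λ d → x ⊓ y < d × All (_< d) P) S
  split-after-first-two =
    takeWhile Low? r , dropWhile Low? r , sym (takeWhile++dropWhile Low? r) , all-takeWhile Low? r ,
    suffix-above (⊆-reflexive (takeWhile++dropWhile Low? r)) (all-takeWhile Low? r) (all-head-dropWhile Low? r)
    where
      Low? : Decidable Low
      Low? u = u <? x ⊔ y ⊎-dec u ≤? x ⊓ y

cut-in-interval : ∀ {A B x y r} → A < B → All (λ z → A ≤ z × z ≤ B) (x ∷ y ∷ r) →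
  ¬ (B ∷ B ∷ B ∷ [] ⊆ x ∷ y ∷ r) → ¬ HasPattern (x ∷ y ∷ r) → ∃[ γ ] (A ≤ γ × γ < B × SplitsAt γ r)
cut-in-interval {A} {B} {x} {y} A<B ((A≤x , x≤B) ∷ (A≤y , y≤B) ∷ _) no-BBB avoids
  with split-after-first-two avoids
... | P , S , refl , lowP , highS =
  max A P , ⊥≤max A P , max<v⁺ A<B (All.tabulate low<B) , P , S , refl , xs≤max A P , All.map above highS
  where
    -- A low letter u ≤ x ⊓ y can only reach B if x = y = u = B, a third copy of B.
    low<B : ∀ {u} → u ∈ P → u < B
    low<B u∈P with All.lookup lowP u∈P
    ... | inj₁ u<M  = <-≤-trans u<M (⊔-lub x≤B y≤B)
    ... | inj₂ u≤lo = ≤∧≢⇒< (≤-trans u≤lo (≤-trans (m⊓n≤m x y) x≤B)) λ { refl →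
      no-BBB (≤-antisym (≤-trans u≤lo (m⊓n≤m x y)) x≤B ∷ ≤-antisym (≤-trans u≤lo (m⊓n≤n x y)) y≤B ∷
              from∈ (∈-++⁺ˡ u∈P)) }

    above : ∀ {d} → x ⊓ y < d × All (_< d) P → max A P < d
    above (lo<d , P<d) = max<v⁺ (≤-<-trans (⊓-glb A≤x A≤y) lo<d) P<d

restriction-cuttable : ∀ {A B} w → A < B → All (λ z → A ≤ z × z ≤ B) w → B ∷ B ∷ [] ⊆ w →
  ¬ (B ∷ B ∷ B ∷ [] ⊆ w) → ¬ HasPattern w → Is2RootedCuttable (suc (B ∸ A)) (map (λ z → suc (z ∸ A)) w)
restriction-cuttable []          _ _ () _ _
restriction-cuttable (x ∷ [])    _ _ (x ∷ʳ ()) _ _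
restriction-cuttable (x ∷ [])    _ _ (_ ∷ ()) _ _
restriction-cuttable {A} (x ∷ y ∷ r) A<B bounds _ no-BBB avoids with cut-in-interval A<B bounds no-BBB avoids
... | γ , A≤γ , γ<B , split =
  suc (γ ∸ A) ,
  SplitsAt⇒Is2RootedCut
    (SplitsAt-map (λ z → suc (z ∸ A)) (λ u≤γ → s≤s (∸-monoˡ-≤ A u≤γ)) (λ γ<u → s≤s (∸-monoˡ-< γ<u A≤γ)) split)
    (s≤s z≤n) (s≤s (∸-monoˡ-< γ<B A≤γ))

avoids⇒fully-cuttable : ∀ n σ → Is2Perm n σ → ¬ HasPattern σ → IsFully2RootedCuttable n σ
avoids⇒fully-cuttable n σ (_ , twice) avoids A B 1≤A A<B B≤n =
  restriction-cuttable (filter (inInterval? A B) σ) A<B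
    (All.map inInterval⁻ (all-filter (inInterval? A B) σ))
    (⊆-filter (inInterval? A B) (B∈[A,B] ∷ B∈[A,B] ∷ []) (two-copies-⊆ {xs = σ} twice-B))
    (λ BBB⊆ → no-three-copies twice-B (⊆-trans BBB⊆ (filter-⊆ (inInterval? A B) σ)))
    (avoids ∘ HasPattern-⊆ (filter-⊆ (inInterval? A B) σ))
  where
    twice-B = twice B (≤-trans 1≤A (<⇒≤ A<B)) B≤n
    B∈[A,B] = inInterval⁺ (<⇒≤ A<B) ≤-refl

mainTheorem10 : (n : ℕ) (σ : List ℕ) → Is2Perm n σ →
    (IsFully2RootedCuttable n σ → Avoids σ) × (Avoids σ → IsFully2RootedCuttable n σ)
mainTheorem10 n σ perm =
  (λ cuttable → fully-cuttable⇒avoids n σ perm cuttable ∘ ContainsPattern⇒HasPattern σ) ,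
  (λ avoids → avoids⇒fully-cuttable n σ perm (avoids ∘ HasPattern⇒ContainsPattern σ))
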